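{- Let $n\geq 5$. Among all chemical trees with $n$ vertices, the path $P_{n}$ has the minimum value of $ZC_{1}^{*}$; that is, $ZC_{1}^{*}(T)\geq ZC_{1}^{*}(P_{n})$ for every chemical tree $T$ on $n$ vertices.
   Context: A chemical tree is a tree in which every vertex has degree at most $4$. For a vertex $v$ of a graph $G$, $d_v$ denotes its degree and $\tau_v$ denotes the number of vertices at distance exactly $2$ from $v$. The modified first Zagreb connection index is $ZC_{1}^{*}(G)=\sum_{v\in V(G)}d_{v}\tau_{v}$. $P_n$ denotes the path on $n$ vertices. -}

module Defs where

open import Data.Nat using (ℕ; zero; suc; _+_; _*_; _∸_; _≤_; _≥_)
open import Data.Bool using (Bool; true; false; T; not; _∧_; _∨_)
open import Data.Fin using (Fin; toℕ)
open import Data.Fin.Properties using (_≟_)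
open import Data.List using (List; []; _∷_; map; filter; length)
open import Data.Nat.ListAction using (sum)
open import Data.Bool.ListAction using (any)
open import Data.List using (allFin)
open import Data.Product using (Σ; _×_; ∃)
open import Relation.Nullary.Decidable using (⌊_⌋)
open import Relation.Binary.PropositionalEquality using (_≡_)

record Graph (n : ℕ) : Set where
  field
    adj   : Fin n → Fin n → Bool
    adj-sym    : ∀ u v → adj u v ≡ adj v u
    adj-irrefl : ∀ v → adj v v ≡ false
open Graph public

count : ∀ {n} → (Fin n → Bool) → ℕ
count {n} p = length (filter (λ x → T? (p x)) (allFin n))
  where
  open import Data.Bool.Properties using (T?)

deg : ∀ {n} → Graph n → Fin n → ℕ
deg G v = count (adj G v)

edges : ∀ {n} → Graph n → ℕ
edges {n} G = sum (map (λ u → count (λ v → adj G u v ∧ ⌊ toℕ u Data.Nat.<? toℕ v ⌋)) (allFin n))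
  where import Data.Nat

data Walk {n} (G : Graph n) : Fin n → Fin n → Set where
  here : ∀ {v} → Walk G v v
  step : ∀ {u w v} → T (adj G u w) → Walk G w v → Walk G u v

walkLength : ∀ {n} {G : Graph n} {u v} → Walk G u v → ℕ
walkLength here = 0
walkLength (step _ w) = suc (walkLength w)

Connected : ∀ {n} → Graph n → Set
Connected G = ∀ u v → Walk G u v

IsTree : ∀ {n} → Graph n → Set
IsTree {n} G = Connected G × edges G ≡ n ∸ 1

IsChemicalTree : ∀ {n} → Graph n → Set
IsChemicalTree G = IsTree G × (∀ v → deg G v ≤ 4)

-- distance exactly 2 (decided): u ≠ v, u not adjacent to v, and u, v
-- have a common neighbour.  (Shortest walk has length exactly 2.)
dist2 : ∀ {n} → Graph n → Fin n → Fin n → Bool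
dist2 {n} G v u =
  not ⌊ v ≟ u ⌋ ∧ not (adj G v u) ∧ any (λ w → adj G v w ∧ adj G w u) (allFin n)

tau : ∀ {n} → Graph n → Fin n → ℕ
tau G v = count (dist2 G v)

ZC1* : ∀ {n} → Graph n → ℕ
ZC1* {n} G = sum (map (λ v → deg G v * tau G v) (allFin n))

pathAdj : ∀ {n} → Fin n → Fin n → Bool
pathAdj i j = ⌊ suc (toℕ i) Data.Nat.≟ toℕ j ⌋ ∨ ⌊ suc (toℕ j) Data.Nat.≟ toℕ i ⌋
  where import Data.Nat

pathGraph : (n : ℕ) → Graph n
pathGraph n = record { adj = pathAdj ; adj-sym = s ; adj-irrefl = r }
  where
  open import Data.Bool.Properties using (∨-comm)
  open import Data.Nat.Properties using (<-irrefl; n<1+n)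
  import Data.Nat
  s : ∀ i j → pathAdj {n} i j ≡ pathAdj j i
  s i j = ∨-comm ⌊ suc (toℕ i) Data.Nat.≟ toℕ j ⌋ ⌊ suc (toℕ j) Data.Nat.≟ toℕ i ⌋
  open import Relation.Nullary using (yes; no)
  open import Relation.Binary.PropositionalEquality using (refl; sym)
  open import Data.Empty using (⊥-elim)
  r : ∀ v → pathAdj {n} v v ≡ false
  r v with suc (toℕ v) Data.Nat.≟ toℕ v
  ... | yes e = ⊥-elim (<-irrefl (sym e) (n<1+n (toℕ v)))
  ... | no _ = refl

module Submission where

-- Let x_w = d_w − 1, let nb₂(v) = Σ_{w∼v} x_w count the walks v, w, u with
-- u ≠ v, and S(G) = Σ_v d_v nb₂(v).  Every vertex at distance 2 from v ends
-- such a walk, so ZC₁*(G) ≤ S(G) for every graph (GraphFacts), with equality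
-- when there are no triangles and no 4-cycles.  From degree data alone,
-- S ≥ 4n − 10 whenever Σ d_v = 2n − 2, there are no isolated vertices and no
-- two leaves are adjacent; S ≤ 4n − 10 if moreover all degrees are at most 2
-- and there are two leaves (DegreeBounds).  A tree on n ≥ 3 vertices meets the
-- first hypotheses and has girth at least 5 (TreeStructure, via a
-- breadth-first search tree); the path meets the second.

open import Defs
open import Data.Nat using (ℕ; zero; suc; _+_; _*_; _∸_; _≤_; _<_; _≥_; z≤n; s≤s; _≟_; _<?_; _≤?_; _<ᵇ_)
open import Data.Nat.Properties
open import Data.Bool using (Bool; true; false; T; not; _∧_; _∨_)
open import Data.Bool.Properties using (T?; ∨-zeroʳ; ∧-zeroʳ; ∧-identityʳ)
open import Data.Fin using (Fin; zero; suc; toℕ; fromℕ)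
import Data.Fin.Properties as Fin
open import Data.List using (_∷_; map; filter; length; tabulate; allFin)
import Data.Nat.ListAction as List
open import Data.Bool.ListAction using (any)
open import Data.Product using (Σ; _×_; _,_; proj₁; proj₂)
open import Data.Sum using (_⊎_; inj₁; inj₂)
open import Data.Empty using (⊥; ⊥-elim)
open import Relation.Nullary using (¬_; Dec; yes; no)
open import Relation.Nullary.Decidable using (⌊⌋-map′; isYes≗does)
open import Relation.Nullary.Decidable using (⌊_⌋)
open import Relation.Binary.PropositionalEquality
open import Data.List.Relation.Unary.Any using (here; there)
open import Data.List.Membership.Propositional using (_∈_)
open import Data.List.Membership.Propositional.Properties using (∈-allFin)
open import Algebra.Properties.Semiring.Sum +-*-semiring
  using (sum; sum-cong-≗; ∑-distrib-+; ∑-comm; *-distribˡ-sum; *-distribʳ-sum; sum-replicate-zero)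
open import Data.Nat.Solver using (module +-*-Solver)
open +-*-Solver using (solve; _:+_; _:*_; _:=_; con)

sum-mono : ∀ {n} {f g : Fin n → ℕ} → (∀ x → f x ≤ g x) → sum f ≤ sum g
sum-mono {zero} le = z≤n
sum-mono {suc n} le = +-mono-≤ (le zero) (sum-mono (λ x → le (suc x)))

sum-zero : ∀ {n} {f : Fin n → ℕ} → (∀ x → f x ≡ 0) → sum f ≡ 0
sum-zero {n} e = trans (sum-cong-≗ e) (sum-replicate-zero n)

sum-tight : ∀ {n} {f g : Fin n → ℕ} → (∀ x → f x ≤ g x) → sum g ≤ sum f → ∀ x → f x ≡ g x
sum-tight {suc n} {f} {g} le ge zero =
  ≤-antisym (le zero) (+-cancelʳ-≤ _ _ _ (≤-trans (+-monoʳ-≤ (g zero) (sum-mono (λ x → le (suc x)))) ge))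
sum-tight {suc n} {f} {g} le ge (suc y) =
  sum-tight (λ x → le (suc x)) (+-cancelˡ-≤ _ _ _ (≤-trans (+-monoˡ-≤ _ (le zero)) ge)) y

term≤sum : ∀ {n} (f : Fin n → ℕ) (a : Fin n) → f a ≤ sum f
term≤sum f zero = m≤m+n _ _
term≤sum f (suc a) = ≤-trans (term≤sum (λ x → f (suc x)) a) (m≤n+m _ _)

two-terms≤sum : ∀ {n} (f : Fin n → ℕ) a b → ¬ a ≡ b → f a + f b ≤ sum f
two-terms≤sum f zero zero a≢b = ⊥-elim (a≢b refl)
two-terms≤sum f zero (suc b) _ = +-monoʳ-≤ (f zero) (term≤sum (λ x → f (suc x)) b)
two-terms≤sum f (suc a) zero _ = subst (_≤ sum f) (+-comm (f zero) (f (suc a))) (+-monoʳ-≤ (f zero) (term≤sum (λ x → f (suc x)) a))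
two-terms≤sum f (suc a) (suc b) a≢b =
  ≤-trans (two-terms≤sum (λ x → f (suc x)) a b (λ a≡b → a≢b (cong suc a≡b))) (m≤n+m _ (f zero))

sum-ones : ∀ n → sum {n} (λ _ → 1) ≡ n
sum-ones zero = refl
sum-ones (suc n) = cong suc (sum-ones n)

ind : Bool → ℕ
ind true = 1
ind false = 0

ind≤1 : ∀ b → ind b ≤ 1
ind≤1 true = ≤-refl
ind≤1 false = z≤n

card : ∀ {n} → (Fin n → Bool) → ℕ
card p = sum (λ x → ind (p x))

card-witness : ∀ {n} (p : Fin n → Bool) a → p a ≡ true → 1 ≤ card p
card-witness p a e = subst (_≤ card p) (cong ind e) (term≤sum (λ x → ind (p x)) a)

card-two : ∀ {n} (p : Fin n → Bool) a b → p a ≡ true → p b ≡ true → ¬ a ≡ b → 2 ≤ card p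
card-two p a b pa pb a≢b = subst (_≤ card p) (cong₂ (λ s t → ind s + ind t) pa pb) (two-terms≤sum (λ x → ind (p x)) a b a≢b)

card-none : ∀ {n} (p : Fin n → Bool) → (∀ x → p x ≡ false) → card p ≡ 0
card-none p none = sum-zero (λ x → cong ind (none x))

card-unique : ∀ {n} (p : Fin n → Bool) → (∀ x y → p x ≡ true → p y ≡ true → x ≡ y) → card p ≤ 1
card-unique {zero} p unique = z≤n
card-unique {suc n} p unique with p zero in p0
... | true = ≤-reflexive (cong suc (card-none (λ x → p (suc x)) only-zero))
  where
  only-zero : ∀ x → p (suc x) ≡ false
  only-zero x with p (suc x) in px
  ... | false = refl
  ... | true with unique zero (suc x) p0 px
  ... | ()
... | false = card-unique (λ x → p (suc x)) (λ x y px py → Fin.suc-injective (unique (suc x) (suc y) px py))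

ind-∨ : ∀ a b → (a ≡ true → b ≡ true → ⊥) → ind (a ∨ b) ≡ ind a + ind b
ind-∨ true true disjoint = ⊥-elim (disjoint refl refl)
ind-∨ true false disjoint = refl
ind-∨ false b disjoint = refl

card-⊆-full : ∀ {n} (p q : Fin n → Bool) → (∀ x → p x ≡ true → q x ≡ true) → card q ≤ card p →
              ∀ x → q x ≡ true → p x ≡ true
card-⊆-full p q p⊆q q≤p x qx = ind-true (p x) (trans (sum-tight pointwise q≤p x) (cong ind qx))
  where
  pointwise : ∀ y → ind (p y) ≤ ind (q y)
  pointwise y with p y in py
  ... | true rewrite p⊆q y py = ≤-refl
  ... | false = z≤n
  ind-true : ∀ b → ind b ≡ 1 → b ≡ true
  ind-true true _ = refl

card-split : ∀ {n} (p q : Fin n → Bool) → card p ≡ card (λ u → p u ∧ not (q u)) + card (λ u → p u ∧ q u)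
card-split p q = trans (sum-cong-≗ pointwise) (∑-distrib-+ (λ u → ind (p u ∧ not (q u))) (λ u → ind (p u ∧ q u)))
  where
  pointwise : ∀ u → ind (p u) ≡ ind (p u ∧ not (q u)) + ind (p u ∧ q u)
  pointwise u with p u | q u
  ... | true | true = refl
  ... | true | false = refl
  ... | false | _ = refl

card-at : ∀ {n} (p : Fin n → Bool) a → card (λ u → p u ∧ ⌊ a Fin.≟ u ⌋) ≡ ind (p a)
card-at {suc n} p zero = begin
    ind (p zero ∧ true) + card (λ u → p (suc u) ∧ false)
  ≡⟨ cong₂ _+_ (cong ind (∧-identityʳ (p zero))) (card-none _ (λ u → ∧-zeroʳ (p (suc u)))) ⟩
    ind (p zero) + 0
  ≡⟨ +-identityʳ _ ⟩
    ind (p zero)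
  ∎
  where open ≡-Reasoning
card-at {suc n} p (suc a) = begin
    ind (p zero ∧ false) + card (λ u → p (suc u) ∧ ⌊ suc a Fin.≟ suc u ⌋)
  ≡⟨ cong₂ (λ b c → ind b + c) (∧-zeroʳ (p zero))
           (sum-cong-≗ (λ u → cong (λ b → ind (p (suc u) ∧ b)) (⌊⌋-map′ _ _ (a Fin.≟ u)))) ⟩
    card (λ u → p (suc u) ∧ ⌊ a Fin.≟ u ⌋)
  ≡⟨ card-at (λ u → p (suc u)) a ⟩
    ind (p (suc a))
  ∎
  where open ≡-Reasoning

listSum-tabulate : ∀ {A : Set} {n} (h : A → ℕ) (g : Fin n → A) →
                   List.sum (map h (tabulate g)) ≡ sum (λ i → h (g i))
listSum-tabulate {n = zero} h g = refl
listSum-tabulate {n = suc n} h g = cong (h (g zero) +_) (listSum-tabulate h (λ i → g (suc i)))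

count-tabulate : ∀ {A : Set} {n} (q : A → Bool) (g : Fin n → A) →
                 length (filter (λ x → T? (q x)) (tabulate g)) ≡ card (λ i → q (g i))
count-tabulate {n = zero} q g = refl
count-tabulate {n = suc n} q g with q (g zero)
... | true = cong suc (count-tabulate q (λ i → g (suc i)))
... | false = count-tabulate q (λ i → g (suc i))

count≡card : ∀ {n} (p : Fin n → Bool) → count p ≡ card p
count≡card p = count-tabulate p (λ x → x)

ZC1*≡sum : ∀ {n} (G : Graph n) → ZC1* G ≡ sum (λ v → deg G v * tau G v)
ZC1*≡sum G = listSum-tabulate (λ v → deg G v * tau G v) (λ x → x)

any-witness : ∀ {A : Set} (p : A → Bool) xs → any p xs ≡ true → Σ A (λ x → p x ≡ true)
any-witness p (x ∷ xs) e with p x in px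
... | true = x , px
... | false = any-witness p xs e

any-intro : ∀ {n} (p : Fin n → Bool) a → p a ≡ true → any p (allFin n) ≡ true
any-intro {n} p a pa = go (∈-allFin a)
  where
  go : ∀ {xs} → a ∈ xs → any p xs ≡ true
  go (here refl) rewrite pa = refl
  go {x ∷ _} (there a∈xs) = trans (cong (p x ∨_) (go a∈xs)) (∨-zeroʳ (p x))

∧-elimˡ : ∀ a {b} → a ∧ b ≡ true → a ≡ true
∧-elimˡ true _ = refl

∧-elimʳ : ∀ a {b} → a ∧ b ≡ true → b ≡ true
∧-elimʳ true e = e

not-true : ∀ {a} → not a ≡ true → a ≡ false
not-true {false} _ = refl

does-true : ∀ {A : Set} (a? : Dec A) → ⌊ a? ⌋ ≡ true → A
does-true (yes a) _ = a

does-false : ∀ {A : Set} (a? : Dec A) → ⌊ a? ⌋ ≡ false → ¬ A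
does-false (no ¬a) _ = ¬a

⌊⌋-false : ∀ {A : Set} (a? : Dec A) → ¬ A → ⌊ a? ⌋ ≡ false
⌊⌋-false (yes a) ¬a = ⊥-elim (¬a a)
⌊⌋-false (no _) _ = refl

T⇒≡true : ∀ {b} → T b → b ≡ true
T⇒≡true {true} _ = refl

module GraphFacts {n : ℕ} (G : Graph n) where

  A : Fin n → Fin n → Bool
  A = adj G

  d : Fin n → ℕ
  d = deg G

  adj-symm : ∀ u v → A u v ≡ true → A v u ≡ true
  adj-symm u v e = trans (adj-sym G v u) e

  adj-distinct : ∀ u v → A u v ≡ true → ¬ u ≡ v
  adj-distinct u .u e refl with trans (sym e) (adj-irrefl G u)
  ... | ()

  deg≡card : ∀ v → d v ≡ card (A v)
  deg≡card v = count≡card (A v)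

  leaf-neighbour-unique : ∀ u v w → d u ≡ 1 → A u v ≡ true → A u w ≡ true → w ≡ v
  leaf-neighbour-unique u v w d≡1 uv uw with w Fin.≟ v
  ... | yes w≡v = w≡v
  ... | no w≢v with ≤-trans (card-two (A u) v w uv uw (λ v≡w → w≢v (sym v≡w))) (≤-reflexive (trans (sym (deg≡card u)) d≡1))
  ... | s≤s ()

  -- Handshake lemma: the degrees add up to twice the number of edges.  Each
  -- adjacency u ∼ v is an edge counted at u (if u < v) or at v (if v < u).
  private
    E : Fin n → Fin n → Bool
    E u v = A u v ∧ ⌊ toℕ u <? toℕ v ⌋

    edges≡sum : edges G ≡ sum (λ u → card (E u))
    edges≡sum = trans (listSum-tabulate (λ u → count (E u)) (λ x → x)) (sum-cong-≗ (λ u → count≡card (E u)))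

    adj-split : ∀ u v → ind (A u v) ≡ ind (E u v) + ind (E v u)
    adj-split u v with A u v in e
    ... | false rewrite trans (adj-sym G v u) e = refl
    ... | true rewrite adj-symm u v e with toℕ u <? toℕ v | toℕ v <? toℕ u
    ... | yes u<v | yes v<u = ⊥-elim (<-asym u<v v<u)
    ... | yes _ | no _ = refl
    ... | no _ | yes _ = refl
    ... | no u≮v | no v≮u = ⊥-elim (adj-distinct u v e (Fin.toℕ-injective (≤-antisym (≮⇒≥ v≮u) (≮⇒≥ u≮v))))

  handshake : sum d ≡ edges G + edges G
  handshake = begin
      sum d
    ≡⟨ sum-cong-≗ (λ u → trans (deg≡card u) (sum-cong-≗ (adj-split u))) ⟩
      sum (λ u → sum (λ v → ind (E u v) + ind (E v u)))
    ≡⟨ sum-cong-≗ (λ u → ∑-distrib-+ (λ v → ind (E u v)) (λ v → ind (E v u))) ⟩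
      sum (λ u → card (E u) + sum (λ v → ind (E v u)))
    ≡⟨ ∑-distrib-+ (λ u → card (E u)) (λ u → sum (λ v → ind (E v u))) ⟩
      sum (λ u → card (E u)) + sum (λ u → sum (λ v → ind (E v u)))
    ≡⟨ cong (sum (λ u → card (E u)) +_) (∑-comm (λ v u → ind (E v u))) ⟨
      sum (λ u → card (E u)) + sum (λ u → card (E u))
    ≡⟨ cong₂ _+_ edges≡sum edges≡sum ⟨
      edges G + edges G
    ∎
    where open ≡-Reasoning

  -- x v = d v − 1 is the number of ways a walk entering v can leave it again.
  x : Fin n → ℕ
  x v = d v ∸ 1

  -- nb₂ v = Σ_{w ∼ v} x_w counts the walks v, w, u with u ≠ v.
  nb₂ : Fin n → ℕ
  nb₂ v = sum (λ w → ind (A v w) * x w)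

  -- S = Σ_v d_v · nb₂ v, the quantity that replaces ZC₁* in the estimates.
  S : ℕ
  S = sum (λ v → d v * nb₂ v)

  midpoint : Fin n → Fin n → Fin n → Bool
  midpoint v u w = A v w ∧ (A w u ∧ not ⌊ v Fin.≟ u ⌋)

  card-other-neighbours : ∀ v w → A w v ≡ true → card (λ u → A w u ∧ not ⌊ v Fin.≟ u ⌋) ≡ x w
  card-other-neighbours v w e = sym (begin
      d w ∸ 1
    ≡⟨ cong (_∸ 1) (trans (deg≡card w) (card-split (A w) (λ u → ⌊ v Fin.≟ u ⌋))) ⟩
      (card (λ u → A w u ∧ not ⌊ v Fin.≟ u ⌋) + card (λ u → A w u ∧ ⌊ v Fin.≟ u ⌋)) ∸ 1
    ≡⟨ cong (λ c → (card (λ u → A w u ∧ not ⌊ v Fin.≟ u ⌋) + c) ∸ 1) (trans (card-at (A w) v) (cong ind e)) ⟩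
      (card (λ u → A w u ∧ not ⌊ v Fin.≟ u ⌋) + 1) ∸ 1
    ≡⟨ m+n∸n≡m _ 1 ⟩
      card (λ u → A w u ∧ not ⌊ v Fin.≟ u ⌋)
    ∎)
    where open ≡-Reasoning

  -- Counting the walks from v by their far end u instead of their middle w.
  nb₂≡walks : ∀ v → nb₂ v ≡ sum (λ u → card (λ w → midpoint v u w))
  nb₂≡walks v = trans (sym (sum-cong-≗ by-middle)) (∑-comm (λ w u → ind (midpoint v u w)))
    where
    by-middle : ∀ w → sum (λ u → ind (midpoint v u w)) ≡ ind (A v w) * x w
    by-middle w with A v w in e
    ... | true = trans (card-other-neighbours v w (adj-symm v w e)) (sym (+-identityʳ (x w)))
    ... | false = sum-replicate-zero n

  -- Every vertex at distance 2 is the far end of such a walk, so τ_v ≤ nb₂ v.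
  tau≤nb₂ : ∀ v → tau G v ≤ nb₂ v
  tau≤nb₂ v = subst₂ _≤_ (sym (count≡card (dist2 G v))) (sym (nb₂≡walks v)) (sum-mono at)
    where
    at : ∀ u → ind (dist2 G v u) ≤ card (λ w → midpoint v u w)
    at u with dist2 G v u in e
    ... | false = z≤n
    ... | true with any-witness _ (allFin n) (∧-elimʳ (not (A v u)) (∧-elimʳ (not ⌊ v Fin.≟ u ⌋) e))
    ... | w , vwu = card-witness (λ w → midpoint v u w) w
          (subst₂ (λ a b → a ∧ (b ∧ not ⌊ v Fin.≟ u ⌋) ≡ true) (sym (∧-elimˡ (A v w) vwu)) (sym (∧-elimʳ (A v w) vwu))
            (∧-elimˡ (not ⌊ v Fin.≟ u ⌋) e))

  ZC≤S : ZC1* G ≤ S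
  ZC≤S = subst (_≤ S) (sym (ZC1*≡sum G)) (sum-mono (λ v → *-monoʳ-≤ (d v) (tau≤nb₂ v)))

  -- Graphs of girth at least 5: no triangles, and two distinct vertices have
  -- at most one common neighbour (no 4-cycles).
  NoTriangle : Set
  NoTriangle = ∀ a b c → A a b ≡ true → A b c ≡ true → A a c ≡ true → ⊥

  UniqueMidpoints : Set
  UniqueMidpoints = ∀ v u w w' → ¬ v ≡ u → A v w ≡ true → A w u ≡ true → A v w' ≡ true → A w' u ≡ true → w ≡ w'

  -- In such graphs each walk v, w, u (u ≠ v) ends at distance exactly 2 and
  -- is the only one reaching u, so nb₂ v ≤ τ_v and S ≤ ZC₁*.
  module Girth5 (no-triangle : NoTriangle) (unique-midpoints : UniqueMidpoints) where

    nb₂≤tau : ∀ v → nb₂ v ≤ tau G v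
    nb₂≤tau v = subst₂ _≤_ (sym (nb₂≡walks v)) (sym (count≡card (dist2 G v))) (sum-mono at)
      where
      parts : ∀ {u w} → midpoint v u w ≡ true → (A v w ≡ true) × (A w u ≡ true) × ¬ v ≡ u
      parts {u} {w} e = ∧-elimˡ (A v w) e , ∧-elimˡ (A w u) (∧-elimʳ (A v w) e) ,
                        does-false (v Fin.≟ u) (not-true (∧-elimʳ (A w u) (∧-elimʳ (A v w) e)))
      at : ∀ u → card (λ w → midpoint v u w) ≤ ind (dist2 G v u)
      at u with dist2 G v u in e
      ... | true = card-unique (λ w → midpoint v u w) (λ w w' vwu vw'u →
            let (vw , wu , v≢u) = parts vwu ; (vw' , w'u , _) = parts vw'u
            in unique-midpoints v u w w' v≢u vw wu vw' w'u)
      ... | false = ≤-reflexive (card-none (λ w → midpoint v u w) no-walk)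
        where
        no-walk : ∀ w → midpoint v u w ≡ false
        no-walk w with midpoint v u w in vwu
        ... | false = refl
        ... | true with parts vwu
        ... | vw , wu , v≢u with A v u in vu
        ... | true = ⊥-elim (no-triangle v w u vw wu vu)
        ... | false with trans (sym e) (cong₂ (λ a b → not a ∧ b) (⌊⌋-false (v Fin.≟ u) v≢u)
                                              (any-intro (λ w → A v w ∧ A w u) w (cong₂ _∧_ vw wu)))
        ... | ()

    S≤ZC : S ≤ ZC1* G
    S≤ZC = subst (S ≤_) (sym (ZC1*≡sum G)) (sum-mono (λ v → *-monoʳ-≤ (d v) (nb₂≤tau v)))

leaf-mark inner-mark : ℕ → ℕ
leaf-mark 1 = 1
leaf-mark _ = 0
inner-mark 1 = 0
inner-mark _ = 1

module DegreeBounds {n : ℕ} (G : Graph n)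
    (deg≥1 : ∀ v → 1 ≤ deg G v)
    (leaves-apart : ∀ v w → adj G v w ≡ true → deg G v ≡ 1 → deg G w ≡ 1 → ⊥)
    (degree-sum : sum (deg G) + 2 ≡ n + n) where

  open GraphFacts G

  a : Fin n → Fin n → ℕ
  a v w = ind (A v w)

  a-sym : ∀ v w → a v w ≡ a w v
  a-sym v w = cong ind (adj-sym G v w)

  ℓ ι : Fin n → ℕ
  ℓ v = leaf-mark (d v)
  ι v = inner-mark (d v)

  L I X : ℕ
  L = sum ℓ
  I = sum ι
  X = sum x

  data Kind (v : Fin n) : Set where
    leaf  : d v ≡ 1 → ℓ v ≡ 1 → ι v ≡ 0 → Kind v
    inner : 2 ≤ d v → ℓ v ≡ 0 → ι v ≡ 1 → Kind v

  kind : ∀ v → Kind v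
  kind v = classify (d v) refl (deg≥1 v)
    where
    classify : ∀ k → d v ≡ k → 1 ≤ k → Kind v
    classify 1 d≡1 _ = leaf d≡1 (cong leaf-mark d≡1) (cong inner-mark d≡1)
    classify (suc (suc k)) d≡k _ =
      inner (subst (2 ≤_) (sym d≡k) (s≤s (s≤s z≤n))) (cong leaf-mark d≡k) (cong inner-mark d≡k)

  x+1≡d : ∀ v → x v + 1 ≡ d v
  x+1≡d v = m∸n+n≡m (deg≥1 v)

  ι+ℓ≡1 : ∀ v → ι v + ℓ v ≡ 1
  ι+ℓ≡1 v with kind v
  ... | leaf _ ℓ≡1 ι≡0 rewrite ℓ≡1 | ι≡0 = refl
  ... | inner _ ℓ≡0 ι≡1 rewrite ℓ≡0 | ι≡1 = refl

  ι≤x : ∀ v → ι v ≤ x v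
  ι≤x v with kind v
  ... | leaf _ _ ι≡0 rewrite ι≡0 = z≤n
  ... | inner 2≤d _ ι≡1 rewrite ι≡1 = ∸-monoˡ-≤ 1 2≤d

  leaf-neighbour : ∀ v w → A v w ≡ true → d w ≡ 1 → ι v ≡ 1
  leaf-neighbour v w vw d≡1 with kind v
  ... | leaf dv≡1 _ _ = ⊥-elim (leaves-apart v w vw dv≡1 d≡1)
  ... | inner _ _ ι≡1 = ι≡1

  I+L≡n : I + L ≡ n
  I+L≡n = trans (sym (∑-distrib-+ ι ℓ)) (trans (sum-cong-≗ ι+ℓ≡1) (sum-ones n))

  X+n≡D : X + n ≡ sum d
  X+n≡D = trans (cong (X +_) (sym (sum-ones n))) (trans (sym (∑-distrib-+ x (λ _ → 1))) (sum-cong-≗ x+1≡d))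

  -- Writing d_v = x_v + 1 splits S into Q = Σ_{v∼w} x_v x_w and R = Σ_v nb₂ v.
  Q R Q₀ : ℕ
  Q = sum (λ v → sum (λ w → a v w * (x v * x w)))
  R = sum nb₂
  Q₀ = sum (λ v → sum (λ w → a v w * (ι v * ι w)))

  S≡Q+R : S ≡ Q + R
  S≡Q+R = trans (sum-cong-≗ at) (∑-distrib-+ (λ v → sum (λ w → a v w * (x v * x w))) nb₂)
    where
    at : ∀ v → d v * nb₂ v ≡ sum (λ w → a v w * (x v * x w)) + nb₂ v
    at v = begin
        d v * nb₂ v
      ≡⟨ cong (_* nb₂ v) (sym (x+1≡d v)) ⟩
        (x v + 1) * nb₂ v
      ≡⟨ trans (*-distribʳ-+ (nb₂ v) (x v) 1) (cong (x v * nb₂ v +_) (*-identityˡ (nb₂ v))) ⟩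
        x v * nb₂ v + nb₂ v
      ≡⟨ cong (_+ nb₂ v) (trans (*-distribˡ-sum (x v) (λ w → a v w * x w))
                                (sum-cong-≗ (λ w → solve 3 (λ p q r → p :* (q :* r) := q :* (p :* r)) refl (x v) (a v w) (x w)))) ⟩
        sum (λ w → a v w * (x v * x w)) + nb₂ v
      ∎
      where open ≡-Reasoning

  -- Each w is the middle vertex of d_w walks, so R = Σ_w x_w d_w.
  R≡Σxd : R ≡ sum (λ w → x w * d w)
  R≡Σxd = trans (∑-comm (λ v w → a v w * x w)) (sum-cong-≗ at)
    where
    at : ∀ w → sum (λ v → a v w * x w) ≡ x w * d w
    at w = begin
        sum (λ v → a v w * x w)
      ≡⟨ *-distribʳ-sum (x w) (λ v → a v w) ⟨
        sum (λ v → a v w) * x w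
      ≡⟨ cong (_* x w) (trans (sum-cong-≗ (λ v → a-sym v w)) (sym (deg≡card w))) ⟩
        d w * x w
      ≡⟨ *-comm (d w) (x w) ⟩
        x w * d w
      ∎
      where open ≡-Reasoning

  Q₀≤Q : Q₀ ≤ Q
  Q₀≤Q = sum-mono (λ v → sum-mono (λ w → *-monoʳ-≤ (a v w) (*-mono-≤ (ι≤x v) (ι≤x w))))

  -- Q₀ counts ordered pairs of adjacent inner vertices.  Every leaf hangs
  -- on an inner vertex, so Q₀ + 2L = Σ_v d_v.
  Q₀+2L≡D : Q₀ + L + L ≡ sum d
  Q₀+2L≡D = begin
      Q₀ + L + L
    ≡⟨ cong (λ t → Q₀ + t + L) (trans (sym (sum-cong-≗ leaf-edges)) (∑-comm (λ w v → a v w * (ι v * ℓ w)))) ⟩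
      Q₀ + sum (λ v → sum (λ w → a v w * (ι v * ℓ w))) + L
    ≡⟨ cong (_+ L) (sym (∑-distrib-+ (λ v → sum (λ w → a v w * (ι v * ι w))) (λ v → sum (λ w → a v w * (ι v * ℓ w))))) ⟩
      sum (λ v → sum (λ w → a v w * (ι v * ι w)) + sum (λ w → a v w * (ι v * ℓ w))) + L
    ≡⟨ cong (_+ L) (sum-cong-≗ inner-edges) ⟩
      sum (λ v → ι v * d v) + L
    ≡⟨ sym (∑-distrib-+ (λ v → ι v * d v) ℓ) ⟩
      sum (λ v → ι v * d v + ℓ v)
    ≡⟨ sum-cong-≗ split-degree ⟩
      sum d
    ∎
    where
    open ≡-Reasoning
    leaf-edges : ∀ w → sum (λ v → a v w * (ι v * ℓ w)) ≡ ℓ w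
    leaf-edges w with kind w
    ... | inner _ ℓ≡0 _ rewrite ℓ≡0 = sum-zero (λ v → trans (cong (a v w *_) (*-zeroʳ (ι v))) (*-zeroʳ (a v w)))
    ... | leaf d≡1 ℓ≡1 _ rewrite ℓ≡1 =
      trans (sum-cong-≗ at) (trans (sum-cong-≗ (λ v → a-sym v w)) (trans (sym (deg≡card w)) d≡1))
      where
      at : ∀ v → a v w * (ι v * 1) ≡ a v w
      at v with A v w in vw
      ... | false = refl
      ... | true rewrite leaf-neighbour v w vw d≡1 = refl
    inner-edges : ∀ v → sum (λ w → a v w * (ι v * ι w)) + sum (λ w → a v w * (ι v * ℓ w)) ≡ ι v * d v
    inner-edges v = begin
        sum (λ w → a v w * (ι v * ι w)) + sum (λ w → a v w * (ι v * ℓ w))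
      ≡⟨ ∑-distrib-+ (λ w → a v w * (ι v * ι w)) (λ w → a v w * (ι v * ℓ w)) ⟨
        sum (λ w → a v w * (ι v * ι w) + a v w * (ι v * ℓ w))
      ≡⟨ sum-cong-≗ (λ w → trans (solve 4 (λ p q r s → p :* (q :* r) :+ p :* (q :* s) := q :* p :* (r :+ s)) refl (a v w) (ι v) (ι w) (ℓ w))
                                 (trans (cong (ι v * a v w *_) (ι+ℓ≡1 w)) (*-identityʳ _))) ⟩
        sum (λ w → ι v * a v w)
      ≡⟨ trans (sym (*-distribˡ-sum (ι v) (a v))) (cong (ι v *_) (sym (deg≡card v))) ⟩
        ι v * d v
      ∎
    split-degree : ∀ v → ι v * d v + ℓ v ≡ d v
    split-degree v with kind v
    ... | leaf d≡1 ℓ≡1 ι≡0 rewrite ℓ≡1 | ι≡0 = sym d≡1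
    ... | inner _ ℓ≡0 ι≡1 rewrite ℓ≡0 | ι≡1 = trans (+-identityʳ _) (+-identityʳ (d v))

  n+n≡Q₀+2L+2 : n + n ≡ Q₀ + L + L + 2
  n+n≡Q₀+2L+2 = trans (sym degree-sum) (cong (_+ 2) (sym Q₀+2L≡D))

  X+2≡n : X + 2 ≡ n
  X+2≡n = +-cancelʳ-≡ n (X + 2) n (begin
      X + 2 + n   ≡⟨ solve 2 (λ p q → p :+ con 2 :+ q := p :+ q :+ con 2) refl X n ⟩
      X + n + 2   ≡⟨ cong (_+ 2) X+n≡D ⟩
      sum d + 2   ≡⟨ degree-sum ⟩
      n + n       ∎)
    where open ≡-Reasoning

  -- For an inner vertex 4(d − 1) ≤ (d − 1)d + 2, i.e. (d − 2)(d − 3) ≥ 0.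
  4x≤xd+2ι : ∀ v → 4 * x v ≤ x v * d v + 2 * ι v
  4x≤xd+2ι v with kind v
  ... | leaf d≡1 _ _ rewrite d≡1 = z≤n
  ... | inner 2≤d _ ι≡1 rewrite ι≡1 = quadratic (d v) 2≤d
    where
    quadratic : ∀ k → 2 ≤ k → 4 * (k ∸ 1) ≤ (k ∸ 1) * k + 2 * 1
    quadratic (suc zero) (s≤s ())
    quadratic (suc (suc y)) _ = begin
        4 * suc y                       ≡⟨ solve 1 (λ y → con 4 :* (con 1 :+ y) := y :+ (con 3 :* y :+ con 4)) refl y ⟩
        y + (3 * y + 4)                 ≤⟨ +-monoˡ-≤ (3 * y + 4) (m≤m*m y) ⟩
        y * y + (3 * y + 4)             ≡⟨ solve 1 (λ y → y :* y :+ (con 3 :* y :+ con 4) := (con 1 :+ y) :* (con 2 :+ y) :+ con 2 :* con 1) refl y ⟩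
        suc y * suc (suc y) + 2 * 1     ∎
      where
      open ≤-Reasoning
      m≤m*m : ∀ m → m ≤ m * m
      m≤m*m zero = z≤n
      m≤m*m (suc m) = m≤m*n (suc m) (suc m)

  -- Summing 4x_v ≤ x_v d_v + 2ι_v: 4(n − 2) ≤ R + 2I = R + 2(n − L).
  R-lower : n + n + (L + L) ≤ R + 8
  R-lower = +-cancelʳ-≤ (2 * I) _ _ (begin
      n + n + (L + L) + 2 * I   ≡⟨ solve 3 (λ p l i → p :+ p :+ (l :+ l) :+ con 2 :* i := p :+ p :+ con 2 :* (i :+ l)) refl n L I ⟩
      n + n + 2 * (I + L)       ≡⟨ cong (λ t → n + n + 2 * t) I+L≡n ⟩
      n + n + 2 * n             ≡⟨ cong (λ t → t + t + 2 * t) X+2≡n ⟨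
      X + 2 + (X + 2) + 2 * (X + 2)  ≡⟨ solve 1 (λ p → p :+ con 2 :+ (p :+ con 2) :+ con 2 :* (p :+ con 2) := con 4 :* p :+ con 8) refl X ⟩
      4 * X + 8                 ≤⟨ +-monoˡ-≤ 8 Σ4x≤R+2I ⟩
      R + 2 * I + 8             ≡⟨ solve 2 (λ r i → r :+ con 2 :* i :+ con 8 := r :+ con 8 :+ con 2 :* i) refl R I ⟩
      R + 8 + 2 * I             ∎)
    where
    open ≤-Reasoning
    Σ4x≤R+2I : 4 * X ≤ R + 2 * I
    Σ4x≤R+2I = subst₂ _≤_ (sym (*-distribˡ-sum 4 x))
                 (trans (∑-distrib-+ (λ v → x v * d v) (λ v → 2 * ι v))
                        (cong₂ _+_ (sym R≡Σxd) (sym (*-distribˡ-sum 2 ι))))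
                 (sum-mono 4x≤xd+2ι)

  -- S = Q + R ≥ Q₀ + R ≥ (2n − 2 − 2L) + (2n − 8 + 2L) = 4n − 10.
  S-lower : 4 * n ≤ S + 10
  S-lower = +-cancelʳ-≤ (L + L) _ _ (begin
      4 * n + (L + L)                          ≡⟨ solve 2 (λ p l → con 4 :* p :+ (l :+ l) := p :+ p :+ (p :+ p :+ (l :+ l))) refl n L ⟩
      n + n + (n + n + (L + L))                ≡⟨ cong (_+ (n + n + (L + L))) n+n≡Q₀+2L+2 ⟩
      Q₀ + L + L + 2 + (n + n + (L + L))       ≤⟨ +-mono-≤ (+-monoˡ-≤ 2 (+-monoˡ-≤ L (+-monoˡ-≤ L Q₀≤Q))) R-lower ⟩
      Q + L + L + 2 + (R + 8)                  ≡⟨ solve 3 (λ q r l → q :+ l :+ l :+ con 2 :+ (r :+ con 8) := q :+ r :+ con 10 :+ (l :+ l)) refl Q R L ⟩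
      Q + R + 10 + (L + L)                     ≡⟨ cong (λ t → t + 10 + (L + L)) S≡Q+R ⟨
      S + 10 + (L + L)                         ∎)
    where open ≤-Reasoning

  -- When all degrees are at most 2 we have x = ι, so Q = Q₀ and R = 2I, and
  -- two leaves give S = 4n − 2 − 4L ≤ 4n − 10.
  module MaxDegree2 (deg≤2 : ∀ v → deg G v ≤ 2)
                    (u₁ u₂ : Fin n) (u₁≢u₂ : ¬ u₁ ≡ u₂) (leaf₁ : deg G u₁ ≡ 1) (leaf₂ : deg G u₂ ≡ 1) where

    two-leaves : 2 ≤ L
    two-leaves = subst (_≤ L) (cong₂ (λ s t → leaf-mark s + leaf-mark t) leaf₁ leaf₂) (two-terms≤sum ℓ u₁ u₂ u₁≢u₂)

    x≡ι : ∀ v → x v ≡ ι v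
    x≡ι v with kind v
    ... | leaf d≡1 _ ι≡0 = trans (cong (_∸ 1) d≡1) (sym ι≡0)
    ... | inner 2≤d _ ι≡1 = trans (cong (_∸ 1) (≤-antisym (deg≤2 v) 2≤d)) (sym ι≡1)

    Q≡Q₀ : Q ≡ Q₀
    Q≡Q₀ = sum-cong-≗ (λ v → sum-cong-≗ (λ w → cong (a v w *_) (cong₂ _*_ (x≡ι v) (x≡ι w))))

    R+2L≡2n : R + L + L ≡ n + n
    R+2L≡2n = begin
        R + L + L                         ≡⟨ cong (λ t → t + L + L) (trans R≡Σxd (sum-cong-≗ xd≡2ι)) ⟩
        sum (λ v → 2 * ι v) + L + L       ≡⟨ cong (λ t → t + L + L) (*-distribˡ-sum 2 ι) ⟨
        2 * I + L + L                     ≡⟨ solve 2 (λ i l → con 2 :* i :+ l :+ l := (i :+ l) :+ (i :+ l)) refl I L ⟩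
        (I + L) + (I + L)                 ≡⟨ cong₂ _+_ I+L≡n I+L≡n ⟩
        n + n                             ∎
      where
      open ≡-Reasoning
      xd≡2ι : ∀ v → x v * d v ≡ 2 * ι v
      xd≡2ι v with kind v
      ... | leaf d≡1 _ ι≡0 rewrite d≡1 | ι≡0 = refl
      ... | inner 2≤d _ ι≡1 rewrite ≤-antisym (deg≤2 v) 2≤d | ι≡1 = refl

    S-upper : S + 10 ≤ 4 * n
    S-upper = begin
        S + 10                                ≡⟨ cong (_+ 10) (trans S≡Q+R (cong (_+ R) Q≡Q₀)) ⟩
        Q₀ + R + 10                           ≡⟨ +-assoc (Q₀ + R) 2 8 ⟨
        Q₀ + R + 2 + 8                        ≤⟨ +-monoʳ-≤ (Q₀ + R + 2) (*-monoʳ-≤ 4 two-leaves) ⟩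
        Q₀ + R + 2 + 4 * L                    ≡⟨ solve 3 (λ q r l → q :+ r :+ con 2 :+ con 4 :* l := (q :+ l :+ l :+ con 2) :+ (r :+ l :+ l)) refl Q₀ R L ⟩
        (Q₀ + L + L + 2) + (R + L + L)        ≡⟨ cong₂ _+_ (sym n+n≡Q₀+2L+2) R+2L≡2n ⟩
        (n + n) + (n + n)                     ≡⟨ solve 1 (λ p → (p :+ p) :+ (p :+ p) := con 4 :* p) refl n ⟩
        4 * n                                 ∎
      where open ≤-Reasoning

least : (P : ℕ → Bool) → ∀ N → P N ≡ true → Σ ℕ (λ k → (P k ≡ true) × (∀ j → j < k → P j ≡ false))
least P zero PN = 0 , PN , (λ j ())
least P (suc N) PN with P 0 in P0
... | true = 0 , P0 , (λ j ())
... | false with least (λ k → P (suc k)) N PN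
... | k , Pk , below = suc k , Pk , earlier
  where
  earlier : ∀ j → j < suc k → P j ≡ false
  earlier zero _ = P0
  earlier (suc j) (s≤s j<k) = below j j<k

-- A connected graph on m + 1 vertices with m edges has girth at least 5.
-- A breadth-first search from the root 0 gives every other vertex a parent
-- one level closer to the root.  These m child–parent pairs are edges, and
-- since there are only m edges every edge joins a vertex to its parent.  A
-- vertex has only one parent, so along a triangle or a 4-cycle each edge
-- forces the next one to point the same way, and the levels would strictly
-- decrease all the way round the cycle.
module TreeStructure {m : ℕ} (G : Graph (suc m)) (connected : Connected G) (edge-count : edges G ≡ m) where

  open GraphFacts G

  -- reach k v: v is joined to the root by a walk of length at most k.
  reach : ℕ → Fin (suc m) → Bool
  reach zero v = ⌊ v Fin.≟ zero ⌋
  reach (suc k) v = reach k v ∨ any (λ u → reach k u ∧ A u v) (allFin (suc m))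

  reach-walk : ∀ k {u v} (walk : Walk G u v) → reach k u ≡ true → reach (k + walkLength walk) v ≡ true
  reach-walk k here r rewrite +-identityʳ k = r
  reach-walk k {u} (step {w = w} uw walk) r rewrite +-suc k (walkLength walk) =
    reach-walk (suc k) walk
      (trans (cong (reach k w ∨_) (any-intro (λ u' → reach k u' ∧ A u' w) u (cong₂ _∧_ r (T⇒≡true uw))))
             (∨-zeroʳ (reach k w)))

  level-spec : ∀ v → Σ ℕ (λ k → (reach k v ≡ true) × (∀ j → j < k → reach j v ≡ false))
  level-spec v = least (λ k → reach k v) (walkLength (connected zero v)) (reach-walk 0 (connected zero v) refl)

  level : Fin (suc m) → ℕ
  level v = proj₁ (level-spec v)

  level-minimal : ∀ u k → reach k u ≡ true → level u ≤ k
  level-minimal u k r with level-spec u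
  ... | l , _ , below with l ≤? k
  ... | yes l≤k = l≤k
  ... | no l≰k with trans (sym r) (below k (≰⇒> l≰k))
  ... | ()

  parent-exists : ∀ v → ¬ v ≡ zero → Σ (Fin (suc m)) (λ u → (A u v ≡ true) × (level u < level v))
  parent-exists v v≢0 with level-spec v
  ... | zero , r , _ = ⊥-elim (v≢0 (does-true (v Fin.≟ zero) r))
  ... | suc k , r , below with any-witness (λ u → reach k u ∧ A u v) (allFin (suc m))
                                  (subst (λ b → b ∨ any (λ u → reach k u ∧ A u v) (allFin (suc m)) ≡ true) (below k ≤-refl) r)
  ... | u , ru = u , ∧-elimʳ (reach k u) ru , s≤s (level-minimal u k (∧-elimˡ (reach k u) ru))

  parent : Fin (suc m) → Fin (suc m)
  parent v with v Fin.≟ zero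
  ... | yes _ = zero
  ... | no v≢0 = proj₁ (parent-exists v v≢0)

  parent-spec : ∀ v → ¬ v ≡ zero → (A (parent v) v ≡ true) × (level (parent v) < level v)
  parent-spec v v≢0 with v Fin.≟ zero
  ... | yes v≡0 = ⊥-elim (v≢0 v≡0)
  ... | no v≢0' = proj₂ (parent-exists v v≢0')

  Arc : Fin (suc m) → Fin (suc m) → Set
  Arc v w = (¬ v ≡ zero) × (parent v ≡ w)

  arc-level : ∀ {v w} → Arc v w → level w < level v
  arc-level {v} (v≢0 , refl) = proj₂ (parent-spec v v≢0)

  arc-adj : ∀ {v w} → Arc v w → A v w ≡ true
  arc-adj {v} (v≢0 , refl) = adj-symm (parent v) v (proj₁ (parent-spec v v≢0))

  is-parent : Fin (suc m) → Fin (suc m) → Bool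
  is-parent v w = not ⌊ v Fin.≟ zero ⌋ ∧ ⌊ parent v Fin.≟ w ⌋

  is-parent⇒arc : ∀ v w → is-parent v w ≡ true → Arc v w
  is-parent⇒arc v w e = does-false (v Fin.≟ zero) (not-true (∧-elimˡ (not ⌊ v Fin.≟ zero ⌋) e)) ,
                        does-true (parent v Fin.≟ w) (∧-elimʳ (not ⌊ v Fin.≟ zero ⌋) e)

  tree-edge : Fin (suc m) → Fin (suc m) → Bool
  tree-edge v w = is-parent v w ∨ is-parent w v

  tree-edge⇒adj : ∀ v w → tree-edge v w ≡ true → A v w ≡ true
  tree-edge⇒adj v w e with is-parent v w in vw
  ... | true = arc-adj (is-parent⇒arc v w vw)
  ... | false = adj-symm w v (arc-adj (is-parent⇒arc w v e))

  -- Each of the m non-root vertices has one parent, so the tree edges have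
  -- degree sum 2m = Σ d_v; hence they are all the edges.
  tree-degree-sum : sum (λ v → card (tree-edge v)) ≡ m + m
  tree-degree-sum = begin
      sum (λ v → card (tree-edge v))
    ≡⟨ sum-cong-≗ (λ v → trans (sum-cong-≗ (λ w → ind-∨ (is-parent v w) (is-parent w v) (not-both v w)))
                                (∑-distrib-+ (λ w → ind (is-parent v w)) (λ w → ind (is-parent w v)))) ⟩
      sum (λ v → card (is-parent v) + sum (λ w → ind (is-parent w v)))
    ≡⟨ ∑-distrib-+ (λ v → card (is-parent v)) (λ v → sum (λ w → ind (is-parent w v))) ⟩
      sum (λ v → card (is-parent v)) + sum (λ v → sum (λ w → ind (is-parent w v)))
    ≡⟨ cong (sum (λ v → card (is-parent v)) +_) (∑-comm (λ w v → ind (is-parent w v))) ⟨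
      sum (λ v → card (is-parent v)) + sum (λ v → card (is-parent v))
    ≡⟨ cong₂ _+_ one-parent-each one-parent-each ⟩
      m + m
    ∎
    where
    open ≡-Reasoning
    not-both : ∀ v w → is-parent v w ≡ true → is-parent w v ≡ true → ⊥
    not-both v w vw wv = <-asym (arc-level (is-parent⇒arc v w vw)) (arc-level (is-parent⇒arc w v wv))
    one-parent-each : sum (λ v → card (is-parent v)) ≡ m
    one-parent-each = trans (sum-cong-≗ (λ v → card-at (λ _ → not ⌊ v Fin.≟ zero ⌋) (parent v))) (sum-ones m)

  degree-sum : sum d ≡ m + m
  degree-sum = trans handshake (cong₂ _+_ edge-count edge-count)

  tree-edges≤degree : ∀ u → card (tree-edge u) ≤ d u
  tree-edges≤degree u = subst (card (tree-edge u) ≤_) (sym (deg≡card u)) (sum-mono at)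
    where
    at : ∀ w → ind (tree-edge u w) ≤ ind (A u w)
    at w with tree-edge u w in t
    ... | false = z≤n
    ... | true rewrite tree-edge⇒adj u w t = ≤-refl

  adj⇒tree-edge : ∀ v w → A v w ≡ true → tree-edge v w ≡ true
  adj⇒tree-edge v = card-⊆-full (tree-edge v) (A v) (tree-edge⇒adj v) (≤-reflexive (trans (sym (deg≡card v)) equal-count))
    where
    equal-count : d v ≡ card (tree-edge v)
    equal-count = sym (sum-tight tree-edges≤degree (≤-reflexive (trans degree-sum (sym tree-degree-sum))) v)

  every-edge-is-tree-edge : ∀ v w → A v w ≡ true → Arc v w ⊎ Arc w v
  every-edge-is-tree-edge v w vw with is-parent v w in e
  ... | true = inj₁ (is-parent⇒arc v w e)
  ... | false = inj₂ (is-parent⇒arc w v (subst (λ b → b ∨ is-parent w v ≡ true) e (adj⇒tree-edge v w vw)))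

  other-neighbours-are-children : ∀ {p y z} → Arc y p → A y z ≡ true → ¬ p ≡ z → Arc z y
  other-neighbours-are-children {p} {y} {z} (_ , parent≡p) yz p≢z with every-edge-is-tree-edge y z yz
  ... | inj₁ (_ , parent≡z) = ⊥-elim (p≢z (trans (sym parent≡p) parent≡z))
  ... | inj₂ z→y = z→y

  private
    cycle₃ : ∀ {p q r} → p < q → q < r → r < p → ⊥
    cycle₃ p<q q<r r<p = <-irrefl refl (<-trans p<q (<-trans q<r r<p))

    cycle₄ : ∀ {p q r s} → p < q → q < r → r < s → s < p → ⊥
    cycle₄ p<q q<r r<s s<p = cycle₃ p<q q<r (<-trans r<s s<p)

  no-triangle : NoTriangle
  no-triangle a b c ab bc ac with every-edge-is-tree-edge a b ab
  ... | inj₁ a→b = cycle₃ (arc-level a→b) (arc-level c→a) (arc-level b→c)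
    where
    c→a = other-neighbours-are-children a→b ac (adj-distinct b c bc)
    b→c = other-neighbours-are-children c→a (adj-symm b c bc) (adj-distinct a b ab)
  ... | inj₂ b→a = cycle₃ (arc-level b→a) (arc-level c→b) (arc-level a→c)
    where
    c→b = other-neighbours-are-children b→a bc (adj-distinct a c ac)
    a→c = other-neighbours-are-children c→b (adj-symm a c ac) (λ b≡a → adj-distinct a b ab (sym b≡a))

  unique-midpoints : UniqueMidpoints
  unique-midpoints v u w w' v≢u vw wu vw' w'u with w Fin.≟ w'
  ... | yes w≡w' = w≡w'
  ... | no w≢w' with every-edge-is-tree-edge v w vw
  ...   | inj₁ v→w = ⊥-elim (cycle₄ (arc-level v→w) (arc-level w'→v) (arc-level u→w') (arc-level w→u))
    where
    w'→v = other-neighbours-are-children v→w vw' w≢w'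
    u→w' = other-neighbours-are-children w'→v w'u v≢u
    w→u = other-neighbours-are-children u→w' (adj-symm w u wu) (λ w'≡w → w≢w' (sym w'≡w))
  ...   | inj₂ w→v = ⊥-elim (cycle₄ (arc-level w→v) (arc-level u→w) (arc-level w'→u) (arc-level v→w'))
    where
    u→w = other-neighbours-are-children w→v wu v≢u
    w'→u = other-neighbours-are-children u→w (adj-symm w' u w'u) w≢w'
    v→w' = other-neighbours-are-children w'→u (adj-symm v w' vw') (λ u≡v → v≢u (sym u≡v))

first-step : ∀ {n} {G : Graph n} {s t} → Walk G s t → ¬ s ≡ t → Σ (Fin n) (λ z → adj G s z ≡ true)
first-step here s≢t = ⊥-elim (s≢t refl)
first-step (step {w = z} sz _) _ = z , T⇒≡true sz

connected⇒deg≥1 : ∀ {k} (G : Graph (suc (suc k))) → Connected G → ∀ v → 1 ≤ deg G v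
connected⇒deg≥1 G connected v with first-step (connected v (other v)) (other≢ v)
  where
  other : ∀ {k} → Fin (suc (suc k)) → Fin (suc (suc k))
  other zero = suc zero
  other (suc _) = zero
  other≢ : ∀ {k} (v : Fin (suc (suc k))) → ¬ v ≡ other v
  other≢ zero ()
  other≢ (suc _) ()
... | w , vw = subst (1 ≤_) (sym (GraphFacts.deg≡card G v)) (card-witness (adj G v) w vw)

-- With at least three vertices, no two leaves are adjacent: a walk starting
-- in such a pair could never leave it, yet some vertex lies outside.
connected⇒leaves-apart : ∀ {k} (G : Graph (suc (suc (suc k)))) → Connected G →
                         ∀ v w → adj G v w ≡ true → deg G v ≡ 1 → deg G w ≡ 1 → ⊥
connected⇒leaves-apart G connected v w vw dv≡1 dw≡1 with third v w
  where
  third : ∀ {k} (v w : Fin (suc (suc (suc k)))) → Σ (Fin (suc (suc (suc k)))) (λ t → (¬ t ≡ v) × (¬ t ≡ w))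
  third zero zero = suc zero , (λ ()) , (λ ())
  third zero (suc zero) = suc (suc zero) , (λ ()) , (λ ())
  third zero (suc (suc _)) = suc zero , (λ ()) , (λ ())
  third (suc zero) zero = suc (suc zero) , (λ ()) , (λ ())
  third (suc (suc _)) zero = suc zero , (λ ()) , (λ ())
  third (suc _) (suc _) = zero , (λ ()) , (λ ())
... | t , t≢v , t≢w with stays (connected v t) (inj₁ refl)
  where
  open GraphFacts G using (adj-symm; leaf-neighbour-unique)
  stays : ∀ {s r} → Walk G s r → (s ≡ v ⊎ s ≡ w) → (r ≡ v ⊎ r ≡ w)
  stays here s∈ = s∈
  stays (step {w = z} sz walk) (inj₁ refl) = stays walk (inj₂ (leaf-neighbour-unique v w z dv≡1 vw (T⇒≡true sz)))
  stays (step {w = z} sz walk) (inj₂ refl) =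
    stays walk (inj₁ (leaf-neighbour-unique w v z dw≡1 (adj-symm v w vw) (T⇒≡true sz)))
... | inj₁ t≡v = t≢v t≡v
... | inj₂ t≡w = t≢w t≡w

tree-lower-bound : ∀ {m} (T : Graph (suc (suc (suc m)))) → IsTree T → 4 * suc (suc (suc m)) ≤ ZC1* T + 10
tree-lower-bound {m} T (connected , edge-count) = begin
    4 * suc (suc (suc m))    ≤⟨ DegreeBounds.S-lower T (connected⇒deg≥1 T connected) (connected⇒leaves-apart T connected) degree-sum′ ⟩
    S + 10                   ≤⟨ +-monoˡ-≤ 10 (Girth5.S≤ZC no-triangle unique-midpoints) ⟩
    ZC1* T + 10              ∎
  where
  open ≤-Reasoning
  open GraphFacts T
  open TreeStructure T connected edge-count using (no-triangle; unique-midpoints; degree-sum)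
  degree-sum′ : sum d + 2 ≡ suc (suc (suc m)) + suc (suc (suc m))
  degree-sum′ = trans (cong (_+ 2) degree-sum) (solve 1 (λ p → p :+ p :+ con 2 := (con 1 :+ p) :+ (con 1 :+ p)) refl (suc (suc m)))

⌊≟⌋-sym : ∀ a b → ⌊ a ≟ b ⌋ ≡ ⌊ b ≟ a ⌋
⌊≟⌋-sym a b with a ≟ b | b ≟ a
... | yes _ | yes _ = refl
... | no _ | no _ = refl
... | yes a≡b | no b≢a = ⊥-elim (b≢a (sym a≡b))
... | no a≢b | yes b≡a = ⊥-elim (a≢b (sym b≡a))

⌊suc≟suc⌋ : ∀ a b → ⌊ suc a ≟ suc b ⌋ ≡ ⌊ a ≟ b ⌋
⌊suc≟suc⌋ a b = trans (isYes≗does (suc a ≟ suc b)) (sym (isYes≗does (a ≟ b)))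

<ᵇ-irrefl : ∀ a → (a <ᵇ a) ≡ false
<ᵇ-irrefl zero = refl
<ᵇ-irrefl (suc a) = <ᵇ-irrefl a

<⇒<ᵇ≡true : ∀ {a b} → a < b → (a <ᵇ b) ≡ true
<⇒<ᵇ≡true a<b = T⇒≡true (<⇒<ᵇ a<b)

count-index : ∀ n t → card {n} (λ j → ⌊ toℕ j ≟ t ⌋) ≡ ind (t <ᵇ n)
count-index zero t = refl
count-index (suc n) zero = cong suc (card-none {n} (λ j → ⌊ suc (toℕ j) ≟ 0 ⌋) (λ j → refl))
count-index (suc n) (suc t) = trans (sum-cong-≗ {n} (λ j → cong ind (⌊suc≟suc⌋ (toℕ j) t))) (count-index n t)

count-predecessor : ∀ n t → t ≤ n → card {n} (λ j → ⌊ suc (toℕ j) ≟ t ⌋) ≡ ind (0 <ᵇ t)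
count-predecessor n zero _ = card-none {n} (λ j → ⌊ suc (toℕ j) ≟ 0 ⌋) (λ j → refl)
count-predecessor n (suc t) t<n = begin
    card {n} (λ j → ⌊ suc (toℕ j) ≟ suc t ⌋)   ≡⟨ sum-cong-≗ {n} (λ j → cong ind (⌊suc≟suc⌋ (toℕ j) t)) ⟩
    card {n} (λ j → ⌊ toℕ j ≟ t ⌋)             ≡⟨ count-index n t ⟩
    ind (t <ᵇ n)                           ≡⟨ cong ind (<⇒<ᵇ≡true t<n) ⟩
    1                                      ∎
  where open ≡-Reasoning

path-degree : ∀ {n} (i : Fin n) → deg (pathGraph n) i ≡ ind (suc (toℕ i) <ᵇ n) + ind (0 <ᵇ toℕ i)
path-degree {n} i = begin
    deg (pathGraph n) i
  ≡⟨ GraphFacts.deg≡card (pathGraph n) i ⟩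
    card {n} (λ j → ⌊ suc (toℕ i) ≟ toℕ j ⌋ ∨ ⌊ suc (toℕ j) ≟ toℕ i ⌋)
  ≡⟨ sum-cong-≗ split ⟩
    sum {n} (λ j → ind ⌊ suc (toℕ i) ≟ toℕ j ⌋ + ind ⌊ suc (toℕ j) ≟ toℕ i ⌋)
  ≡⟨ ∑-distrib-+ {n} (λ j → ind ⌊ suc (toℕ i) ≟ toℕ j ⌋) (λ j → ind ⌊ suc (toℕ j) ≟ toℕ i ⌋) ⟩
    card {n} (λ j → ⌊ suc (toℕ i) ≟ toℕ j ⌋) + card {n} (λ j → ⌊ suc (toℕ j) ≟ toℕ i ⌋)
  ≡⟨ cong₂ _+_ (trans (sum-cong-≗ flip) (count-index n (suc (toℕ i))))
               (count-predecessor n (toℕ i) (<⇒≤ (Fin.toℕ<n i))) ⟩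
    ind (suc (toℕ i) <ᵇ n) + ind (0 <ᵇ toℕ i)
  ∎
  where
  open ≡-Reasoning
  not-both : (j : Fin n) → ⌊ suc (toℕ i) ≟ toℕ j ⌋ ≡ true → ⌊ suc (toℕ j) ≟ toℕ i ⌋ ≡ true → ⊥
  not-both j ij ji = <-irrefl (sym (trans (cong suc (does-true (suc (toℕ i) ≟ toℕ j) ij)) (does-true (suc (toℕ j) ≟ toℕ i) ji)))
                              (m≤n⇒m≤1+n (n<1+n (toℕ i)))
  flip : (j : Fin n) → ind ⌊ suc (toℕ i) ≟ toℕ j ⌋ ≡ ind ⌊ toℕ j ≟ suc (toℕ i) ⌋
  flip j = cong ind (⌊≟⌋-sym (suc (toℕ i)) (toℕ j))
  split : (j : Fin n) → ind (⌊ suc (toℕ i) ≟ toℕ j ⌋ ∨ ⌊ suc (toℕ j) ≟ toℕ i ⌋) ≡ ind ⌊ suc (toℕ i) ≟ toℕ j ⌋ + ind ⌊ suc (toℕ j) ≟ toℕ i ⌋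
  split j = ind-∨ ⌊ suc (toℕ i) ≟ toℕ j ⌋ ⌊ suc (toℕ j) ≟ toℕ i ⌋ (not-both j)


path-upper-bound : ∀ k → ZC1* (pathGraph (suc (suc (suc k)))) + 10 ≤ 4 * suc (suc (suc k))
path-upper-bound k = ≤-trans (+-monoˡ-≤ 10 ZC≤S) (MaxDegree2.S-upper deg≤2 zero (fromℕ m) (λ ()) end₀ endₘ)
  where
  m : ℕ
  m = suc (suc k)

  open GraphFacts (pathGraph (suc m))

  deg≥1 : ∀ i → 1 ≤ d i
  deg≥1 i rewrite path-degree i with toℕ i
  ... | zero = ≤-refl
  ... | suc _ = m≤n+m 1 _

  deg≤2 : ∀ i → d i ≤ 2
  deg≤2 i rewrite path-degree i = +-mono-≤ (ind≤1 (suc (toℕ i) <ᵇ suc m)) (ind≤1 (0 <ᵇ toℕ i))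

  degree-sum : sum d + 2 ≡ suc m + suc m
  degree-sum = begin
      sum d + 2
    ≡⟨ cong (_+ 2) (trans (sum-cong-≗ (path-degree {suc m})) (∑-distrib-+ {suc m} (λ i → ind (suc (toℕ i) <ᵇ suc m)) (λ i → ind (0 <ᵇ toℕ i)))) ⟩
      sum {suc m} (λ i → ind (suc (toℕ i) <ᵇ suc m)) + sum {suc m} (λ i → ind (0 <ᵇ toℕ i)) + 2
    ≡⟨ cong (λ t → t + 2) (cong₂ _+_ (successors m) (sum-ones m)) ⟩
      m + m + 2
    ≡⟨ solve 1 (λ p → p :+ p :+ con 2 := (con 1 :+ p) :+ (con 1 :+ p)) refl m ⟩
      suc m + suc m
    ∎
    where
    open ≡-Reasoning
    successors : ∀ m → sum {suc m} (λ i → ind (suc (toℕ i) <ᵇ suc m)) ≡ m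
    successors zero = refl
    successors (suc m) = cong suc (successors m)

  leaf-position : ∀ i → d i ≡ 1 → toℕ i ≡ 0 ⊎ toℕ i ≡ m
  leaf-position i d≡1 = position (toℕ i) (Fin.toℕ<n i) (trans (sym (path-degree i)) d≡1)
    where
    position : ∀ t → t < suc m → ind (suc t <ᵇ suc m) + ind (0 <ᵇ t) ≡ 1 → t ≡ 0 ⊎ t ≡ m
    position zero _ _ = inj₁ refl
    position (suc t) (s≤s t<m) e = inj₂ (≤-antisym t<m (≮⇒≥ no-successor))
      where
      no-successor : ¬ suc t < m
      no-successor t+1<m with subst (λ b → ind b + 1 ≡ 1) (<⇒<ᵇ≡true t+1<m) e
      ... | ()

  not-consecutive : ∀ {a b} → a ≡ 0 ⊎ a ≡ m → b ≡ 0 ⊎ b ≡ m → suc a ≡ b → ⊥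
  not-consecutive (inj₁ refl) (inj₁ refl) ()
  not-consecutive (inj₁ refl) (inj₂ refl) ()
  not-consecutive (inj₂ refl) (inj₁ refl) ()
  not-consecutive (inj₂ refl) (inj₂ refl) m+1≡m = <-irrefl (sym m+1≡m) (n<1+n m)

  leaves-apart : ∀ v w → A v w ≡ true → d v ≡ 1 → d w ≡ 1 → ⊥
  leaves-apart v w vw dv≡1 dw≡1 with ⌊ suc (toℕ v) ≟ toℕ w ⌋ in v+1≡w
  ... | true = not-consecutive (leaf-position v dv≡1) (leaf-position w dw≡1) (does-true (suc (toℕ v) ≟ toℕ w) v+1≡w)
  ... | false = not-consecutive (leaf-position w dw≡1) (leaf-position v dv≡1) (does-true (suc (toℕ w) ≟ toℕ v) vw)

  end₀ : d zero ≡ 1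
  end₀ = path-degree {suc m} zero

  endₘ : d (fromℕ m) ≡ 1
  endₘ = begin
      d (fromℕ m)                                            ≡⟨ path-degree (fromℕ m) ⟩
      ind (suc (toℕ (fromℕ m)) <ᵇ suc m) + ind (0 <ᵇ toℕ (fromℕ m))  ≡⟨ cong (λ t → ind (suc t <ᵇ suc m) + ind (0 <ᵇ t)) (Fin.toℕ-fromℕ m) ⟩
      ind (m <ᵇ m) + 1                                       ≡⟨ cong (λ b → ind b + 1) (<ᵇ-irrefl m) ⟩
      1                                                      ∎
    where open ≡-Reasoning

  open DegreeBounds (pathGraph (suc m)) deg≥1 leaves-apart degree-sum

theorem3p1 : (n : ℕ) → n ≥ 5 → (T : Graph n) → IsChemicalTree T →
    ZC1* (pathGraph n) ≤ ZC1* T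
theorem3p1 (suc (suc (suc k))) (s≤s (s≤s (s≤s _))) T (tree , _) =
  +-cancelʳ-≤ 10 _ _ (≤-trans (path-upper-bound k) (tree-lower-bound T tree))
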